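{- For every $l\ge4$, $f_{D_l}(t)=(-1)^lf_{D_l}(1-t)$.
   Context: $f_{D_l}(t)=\sum_{k=0}^l(-1)^k\big(\binom lk\binom{l+k-1}{k}+\binom{l-2}{k-2}\binom{l+k-2}{k}\big)t^k$, with $\binom nm=0$ for $m<0$ (the $f$-polynomial of the cluster complex of type $D_l$). -}

module Defs where

open import Data.Nat using (ℕ; zero; suc; _∸_; _<_)
open import Data.Nat.Combinatorics using (_C_)
open import Data.Integer using (ℤ; +_; _+_; _*_; -_; _-_; 1ℤ; 0ℤ)
open import Data.Integer using () renaming (_^_ to _^ᶻ_)
open import Data.Nat using (_<ᵇ_)
open import Data.Bool using (if_then_else_)

sign : ℕ → ℤ
sign zero = 1ℤ
sign (suc k) = - sign k

binom2 : ℕ → ℕ → ℕ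
binom2 n k = if k <ᵇ 2 then 0 else ((n ∸ 2) C (k ∸ 2))

coeffD : ℕ → ℕ → ℤ
coeffD l k = sign k * (+ ((l C k) Data.Nat.* ((l Data.Nat.+ k ∸ 1) C k)
                           Data.Nat.+ binom2 l k Data.Nat.* ((l Data.Nat.+ k ∸ 2) C k)))

sumTo : ℕ → (ℕ → ℤ) → ℤ
sumTo zero g = 0ℤ
sumTo (suc n) g = sumTo n g + g n

fD : ℕ → ℤ → ℤ
fD l t = sumTo (suc l) (λ k → coeffD l k * (t ^ᶻ k))

-- Put s = -t. Then f_{D_l}(t) = g_l(s) with g_l having the unsigned coefficients of f_{D_l},
-- and t ↦ 1 - t becomes s ↦ -1 - s. The polynomials Q_n(s) = Σ_k C(n,k) C(n+k,k) s^k are the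
-- Legendre polynomials P_n(1 + 2s), so the three-term recurrence
-- (n+2) Q_{n+2} = (2n+3)(1+2s) Q_{n+1} - (n+1) Q_n gives Q_n(-1-s) = (-1)^n Q_n(s) by induction.
-- Comparing coefficients, 2(2m+3) g_{m+2} = (3m+4) Q_{m+2} + (m+2) Q_m, and both summands pick up
-- the sign (-1)^m under s ↦ -1 - s. Each coefficient identity, multiplied by (k!)², turns binomial
-- coefficients into falling factorials and then into a polynomial identity.

module Submission where

open import Defs
open import Data.Nat using (ℕ; zero; suc; _≤_; _<_; s≤s; z≤n)
open import Data.Product using (_×_; _,_; proj₁)
open import Relation.Binary.PropositionalEquality

module _ where
  open import Data.Nat using (pred; _+_; _*_; _∸_; _!)
  open import Data.Nat.Properties
    using (+-identityʳ; +-suc; *-identityˡ; *-zeroʳ; *-assoc; *-distribʳ-+; *-cancelʳ-≡;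
           *-commutativeSemigroup; ≤-<-connex; m<n⇒m<1+n; m≤n⇒m∸n≡0; m+[n∸m]≡n; m+n∸n≡m; m+n∸m≡n;
           ∸-+-assoc; pred[m∸n]≡m∸[1+n]; m≤n⇒∃[o]m+o≡n; _!*_!≢0)
  open import Data.Nat.Combinatorics using (_C_; nC1≡n; nCk+nC[k+1]≡[n+1]C[k+1]; k>n⇒nCk≡0)
  open import Data.Nat.Combinatorics.Base using (_P′_)
  open import Data.Nat.Tactic.RingSolver using (solve-∀)
  open import Algebra.Properties.CommutativeSemigroup *-commutativeSemigroup using (x∙yz≈y∙xz)
  open import Data.Sum using (inj₁; inj₂)

  P′-suc-suc : ∀ n k → suc n P′ suc k ≡ suc n * (n P′ k)
  P′-suc-suc n zero    = refl
  P′-suc-suc n (suc k) = begin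
    (n ∸ k) * (suc n P′ suc k)     ≡⟨ cong ((n ∸ k) *_) (P′-suc-suc n k) ⟩
    (n ∸ k) * (suc n * (n P′ k))   ≡⟨ x∙yz≈y∙xz (n ∸ k) (suc n) (n P′ k) ⟩
    suc n * ((n ∸ k) * (n P′ k))   ∎
    where open ≡-Reasoning

  P′-suc²-suc² : ∀ n k → suc (suc n) P′ suc (suc k) ≡ suc (suc n) * (suc n * (n P′ k))
  P′-suc²-suc² n k = trans (P′-suc-suc (suc n) (suc k)) (cong (suc (suc n) *_) (P′-suc-suc n k))

  P′-vanish : ∀ {n k} → n < k → n P′ k ≡ 0
  P′-vanish {n} {suc k} (s≤s n≤k) = cong (_* (n P′ k)) (m≤n⇒m∸n≡0 n≤k)

  P′-pascal : ∀ n k → suc n P′ suc k ≡ suc k * (n P′ k) + n P′ suc k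
  P′-pascal n k with ≤-<-connex k n
  ... | inj₁ k≤n = begin
    suc n P′ suc k                   ≡⟨ P′-suc-suc n k ⟩
    suc n * (n P′ k)                 ≡⟨ cong (λ x → suc x * (n P′ k)) (m+[n∸m]≡n k≤n) ⟨
    (suc k + (n ∸ k)) * (n P′ k)     ≡⟨ *-distribʳ-+ (n P′ k) (suc k) (n ∸ k) ⟩
    suc k * (n P′ k) + n P′ suc k    ∎
    where open ≡-Reasoning
  ... | inj₂ n<k = begin
    suc n P′ suc k                   ≡⟨ P′-vanish (s≤s n<k) ⟩
    0                                ≡⟨ trans (+-identityʳ (suc k * 0)) (*-zeroʳ (suc k)) ⟨
    suc k * 0 + 0                    ≡⟨ cong₂ (λ x y → suc k * x + y) (P′-vanish n<k) (P′-vanish (m<n⇒m<1+n n<k)) ⟨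
    suc k * (n P′ k) + n P′ suc k    ∎
    where open ≡-Reasoning

  P′-+ : ∀ x r s → x P′ (r + s) ≡ ((x ∸ r) P′ s) * (x P′ r)
  P′-+ x r zero    = trans (cong (x P′_) (+-identityʳ r)) (sym (*-identityˡ (x P′ r)))
  P′-+ x r (suc s) = begin
    x P′ (r + suc s)                           ≡⟨ cong (x P′_) (+-suc r s) ⟩
    (x ∸ (r + s)) * (x P′ (r + s))            ≡⟨ cong₂ _*_ (sym (∸-+-assoc x r s)) (P′-+ x r s) ⟩
    (x ∸ r ∸ s) * (((x ∸ r) P′ s) * (x P′ r))  ≡⟨ *-assoc (x ∸ r ∸ s) _ _ ⟨
    ((x ∸ r) P′ suc s) * (x P′ r)              ∎
    where open ≡-Reasoning

  C*k!≡P′ : ∀ n k → (n C k) * k ! ≡ n P′ k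
  C*k!≡P′ n       zero    = refl
  C*k!≡P′ zero    (suc k) = sym (P′-vanish {0} {suc k} (s≤s z≤n))
  C*k!≡P′ (suc n) (suc k) = begin
    (suc n C suc k) * suc k !                      ≡⟨ cong (_* suc k !) (nCk+nC[k+1]≡[n+1]C[k+1] n k) ⟨
    (n C k + n C suc k) * (suc k * k !)            ≡⟨ distrib (n C k) (n C suc k) (suc k) (k !) ⟩
    suc k * ((n C k) * k !) + (n C suc k) * suc k ! ≡⟨ cong₂ (λ x y → suc k * x + y) (C*k!≡P′ n k) (C*k!≡P′ n (suc k)) ⟩
    suc k * (n P′ k) + n P′ suc k                  ≡⟨ P′-pascal n k ⟨
    suc n P′ suc k                                 ∎
    where
    open ≡-Reasoning
    distrib : ∀ a b c d → (a + b) * (c * d) ≡ c * (a * d) + b * (c * d)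
    distrib = solve-∀

  C*C*k!²≡P′*P′ : ∀ p q k → (p C k) * (q C k) * (k ! * k !) ≡ (p P′ k) * (q P′ k)
  C*C*k!²≡P′*P′ p q k = trans (regroup (p C k) (q C k) (k !)) (cong₂ _*_ (C*k!≡P′ p k) (C*k!≡P′ q k))
    where
    regroup : ∀ a b c → a * b * (c * c) ≡ (a * c) * (b * c)
    regroup = solve-∀

  [m+2+i]∸i≡2+m : ∀ m i → m + suc (suc i) ∸ i ≡ suc (suc m)
  [m+2+i]∸i≡2+m m i = trans (cong (_∸ i) (reorder m i)) (m+n∸n≡m (suc (suc m)) i)
    where
    reorder : ∀ m i → m + suc (suc i) ≡ suc (suc m) + i
    reorder = solve-∀

  [m+2+i]P′[2+i] : ∀ m i → (m + suc (suc i)) P′ suc (suc i) ≡ suc m * (suc (suc m) * ((m + suc (suc i)) P′ i))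
  [m+2+i]P′[2+i] m i = cong₂ (λ p q → p * (q * ((m + suc (suc i)) P′ i))) [m+2+i]∸[1+i]≡1+m ([m+2+i]∸i≡2+m m i)
    where
    [m+2+i]∸[1+i]≡1+m : m + suc (suc i) ∸ suc i ≡ suc m
    [m+2+i]∸[1+i]≡1+m = trans (sym (pred[m∸n]≡m∸[1+n] (m + suc (suc i)) i)) (cong pred ([m+2+i]∸i≡2+m m i))

  legendreCoeff : ℕ → ℕ → ℕ
  legendreCoeff n k = (n C k) * ((n + k) C k)

  legendreCoeff-vanish : ∀ {n k} → n < k → legendreCoeff n k ≡ 0
  legendreCoeff-vanish {n} {k} n<k = cong (_* ((n + k) C k)) (k>n⇒nCk≡0 n<k)

  legendreCoeff*k!² : ∀ n k → legendreCoeff n k * (k ! * k !) ≡ (n + k) P′ (k + k)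
  legendreCoeff*k!² n k = begin
    legendreCoeff n k * (k ! * k !)              ≡⟨ C*C*k!²≡P′*P′ n (n + k) k ⟩
    (n P′ k) * ((n + k) P′ k)                    ≡⟨ cong (λ x → (x P′ k) * ((n + k) P′ k)) (m+n∸n≡m n k) ⟨
    ((n + k ∸ k) P′ k) * ((n + k) P′ k)          ≡⟨ P′-+ (n + k) k k ⟨
    (n + k) P′ (k + k)                           ∎
    where open ≡-Reasoning

  legendreCoeff*[1+i]!² : ∀ n i → legendreCoeff n (suc i) * (suc i ! * suc i !) ≡ (suc n + i) P′ suc (suc (i + i))
  legendreCoeff*[1+i]!² n i = trans (legendreCoeff*k!² n (suc i)) (cong₂ _P′_ (+-suc n i) (cong suc (+-suc i i)))

  shift : (ℕ → ℕ) → ℕ → ℕ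
  shift c zero    = 0
  shift c (suc k) = c k

  [i+d+i]∸[i+i]≡d : ∀ i d → i + d + i ∸ (i + i) ≡ d
  [i+d+i]∸[i+i]≡d i d = trans (cong (_∸ (i + i)) (reorder i d)) (m+n∸n≡m d (i + i))
    where
    reorder : ∀ i d → i + d + i ≡ d + (i + i)
    reorder = solve-∀

  -- legendreCoeff-rec (M ∸ 1) (suc i) times (i+1)!², divided by (M + i) P′ 2i. Since i ≤ M the
  -- truncated differences are exact, except (M + i) ∸ (2i + 1) at i = M, which is multiplied by 0.
  legendreCoeff-rec-reduced : ∀ M i → i ≤ M → let x = M + i in
    suc M * (suc (suc x) * suc x) + M * ((x ∸ suc (i + i)) * (x ∸ (i + i)))
      ≡ suc (2 * M) * (suc x * (x ∸ (i + i)) + 2 * (suc i * suc i))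
  legendreCoeff-rec-reduced M i i≤M with m≤n⇒∃[o]m+o≡n i≤M
  ... | d , refl rewrite sym (pred[m∸n]≡m∸[1+n] (i + d + i) (i + i)) | [i+d+i]∸[i+i]≡d i d = identity d
    where
    identity : ∀ d → suc (i + d) * (suc (suc (i + d + i)) * suc (i + d + i)) + (i + d) * (pred d * d)
                     ≡ suc (2 * (i + d)) * (suc (i + d + i) * d + 2 * (suc i * suc i))
    identity zero    = at0 i
      where at0 : ∀ i → suc (i + 0) * (suc (suc (i + 0 + i)) * suc (i + 0 + i)) + (i + 0) * (0 * 0)
                        ≡ suc (2 * (i + 0)) * (suc (i + 0 + i) * 0 + 2 * (suc i * suc i))
            at0 = solve-∀
    identity (suc e) = atSuc i e
      where atSuc : ∀ i e → suc (i + suc e) * (suc (suc (i + suc e + i)) * suc (i + suc e + i)) + (i + suc e) * (e * suc e)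
                            ≡ suc (2 * (i + suc e)) * (suc (i + suc e + i) * suc e + 2 * (suc i * suc i))
            atSuc = solve-∀

  legendreCoeff-rec-lhs : ∀ m i → let x = suc m + i in
    (suc (suc m) * legendreCoeff (suc (suc m)) (suc i) + suc m * legendreCoeff m (suc i)) * (suc i ! * suc i !)
      ≡ (suc (suc m) * (suc (suc x) * suc x) + suc m * ((x ∸ suc (i + i)) * (x ∸ (i + i)))) * (x P′ (i + i))
  legendreCoeff-rec-lhs m i = begin
    (suc (suc m) * a (suc (suc m)) k + suc m * a m k) * K
      ≡⟨ distrib (suc (suc m)) (a (suc (suc m)) k) (suc m) (a m k) K ⟩
    suc (suc m) * (a (suc (suc m)) k * K) + suc m * (a m k * K)
      ≡⟨ cong₂ (λ p q → suc (suc m) * p + suc m * q) (trans (legendreCoeff*[1+i]!² (suc (suc m)) i) (P′-suc²-suc² x (i + i)))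
                                                           (legendreCoeff*[1+i]!² m i) ⟩
    suc (suc m) * (suc (suc x) * (suc x * z)) + suc m * ((x ∸ suc (i + i)) * ((x ∸ (i + i)) * z))
      ≡⟨ factor (suc m) x (x ∸ (i + i)) (x ∸ suc (i + i)) z ⟩
    (suc (suc m) * (suc (suc x) * suc x) + suc m * ((x ∸ suc (i + i)) * (x ∸ (i + i)))) * z ∎
    where
    open ≡-Reasoning
    a = legendreCoeff
    k = suc i
    K = suc i ! * suc i !
    x = suc m + i
    z = x P′ (i + i)
    distrib : ∀ A α B β K → (A * α + B * β) * K ≡ A * (α * K) + B * (β * K)
    distrib = solve-∀
    factor : ∀ M x u v z → suc M * (suc (suc x) * (suc x * z)) + M * (v * (u * z))
                           ≡ (suc M * (suc (suc x) * suc x) + M * (v * u)) * z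
    factor = solve-∀

  legendreCoeff-rec-rhs : ∀ m i → let x = suc m + i in
    (3 + 2 * m) * (legendreCoeff (suc m) (suc i) + 2 * legendreCoeff (suc m) i) * (suc i ! * suc i !)
      ≡ suc (2 * suc m) * (suc x * (x ∸ (i + i)) + 2 * (suc i * suc i)) * (x P′ (i + i))
  legendreCoeff-rec-rhs m i = begin
    (3 + 2 * m) * (a (suc m) (suc i) + 2 * a (suc m) i) * ((suc i * i !) * (suc i * i !))
      ≡⟨ distrib (3 + 2 * m) (a (suc m) (suc i)) (a (suc m) i) (suc i) (i !) ⟩
    (3 + 2 * m) * (a (suc m) (suc i) * (suc i ! * suc i !) + 2 * (suc i * suc i * (a (suc m) i * (i ! * i !))))
      ≡⟨ cong₂ (λ p q → (3 + 2 * m) * (p + 2 * (suc i * suc i * q)))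
               (trans (legendreCoeff*[1+i]!² (suc m) i) (P′-suc-suc x (suc (i + i)))) (legendreCoeff*k!² (suc m) i) ⟩
    (3 + 2 * m) * (suc x * ((x ∸ (i + i)) * z) + 2 * (suc i * suc i * z))
      ≡⟨ factor m x (x ∸ (i + i)) i z ⟩
    suc (2 * suc m) * (suc x * (x ∸ (i + i)) + 2 * (suc i * suc i)) * z ∎
    where
    open ≡-Reasoning
    a = legendreCoeff
    x = suc m + i
    z = x P′ (i + i)
    distrib : ∀ c α β s f → c * (α + 2 * β) * ((s * f) * (s * f))
                            ≡ c * (α * ((s * f) * (s * f)) + 2 * (s * s * (β * (f * f))))
    distrib = solve-∀
    factor : ∀ m x u i z → (3 + 2 * m) * (suc x * (u * z) + 2 * (suc i * suc i * z))
                           ≡ suc (2 * suc m) * (suc x * u + 2 * (suc i * suc i)) * z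
    factor = solve-∀

  legendreCoeff-rec : ∀ m k → k ≤ suc (suc m) →
    suc (suc m) * legendreCoeff (suc (suc m)) k + suc m * legendreCoeff m k
      ≡ (3 + 2 * m) * (legendreCoeff (suc m) k + 2 * shift (legendreCoeff (suc m)) k)
  legendreCoeff-rec m zero    _           = at0 m
    where
    at0 : ∀ m → suc (suc m) * (1 * 1) + suc m * (1 * 1) ≡ (3 + 2 * m) * (1 * 1 + 2 * 0)
    at0 = solve-∀
  legendreCoeff-rec m (suc i) (s≤s i≤1+m) = *-cancelʳ-≡ _ _ (suc i ! * suc i !) {{suc i !* suc i !≢0}} (
    trans (legendreCoeff-rec-lhs m i)
          (trans (cong (_* ((suc m + i) P′ (i + i))) (legendreCoeff-rec-reduced (suc m) i i≤1+m))
                 (sym (legendreCoeff-rec-rhs m i))))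

  clusterCoeff : ℕ → ℕ → ℕ
  clusterCoeff l k = (l C k) * ((l + k ∸ 1) C k) + binom2 l k * ((l + k ∸ 2) C k)

  -- clusterCoeff-legendre m (2 + i) times (i+2)!², divided by (2+m)(1+m) (m P′ i) ((m+2+i) P′ i);
  -- as in legendreCoeff-rec-reduced, the truncation in m ∸ (i + 1) only matters where it is multiplied by 0.
  clusterCoeff-legendre-reduced : ∀ m i → i ≤ m → let l = suc (suc m); W = m + suc (suc i) in
    2 * (3 + 2 * m) * (suc W * l + suc (suc i) * suc i) ≡ (4 + 3 * m) * (suc (suc W) * suc W) + l * ((m ∸ suc i) * (m ∸ i))
  clusterCoeff-legendre-reduced m i i≤m with m≤n⇒∃[o]m+o≡n i≤m
  ... | d , refl rewrite sym (pred[m∸n]≡m∸[1+n] (i + d) i) | m+n∸m≡n i d = identity d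
    where
    identity : ∀ d → 2 * (3 + 2 * (i + d)) * (suc (i + d + suc (suc i)) * suc (suc (i + d)) + suc (suc i) * suc i)
                     ≡ (4 + 3 * (i + d)) * (suc (suc (i + d + suc (suc i))) * suc (i + d + suc (suc i)))
                       + suc (suc (i + d)) * (pred d * d)
    identity zero    = at0 i
      where at0 : ∀ i → 2 * (3 + 2 * (i + 0)) * (suc (i + 0 + suc (suc i)) * suc (suc (i + 0)) + suc (suc i) * suc i)
                        ≡ (4 + 3 * (i + 0)) * (suc (suc (i + 0 + suc (suc i))) * suc (i + 0 + suc (suc i)))
                          + suc (suc (i + 0)) * (0 * 0)
            at0 = solve-∀
    identity (suc e) = atSuc i e
      where atSuc : ∀ i e → 2 * (3 + 2 * (i + suc e)) * (suc (i + suc e + suc (suc i)) * suc (suc (i + suc e)) + suc (suc i) * suc i)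
                            ≡ (4 + 3 * (i + suc e)) * (suc (suc (i + suc e + suc (suc i))) * suc (i + suc e + suc (suc i)))
                              + suc (suc (i + suc e)) * (e * suc e)
            atSuc = solve-∀

  clusterCoeff*k!² : ∀ m i → let l = suc (suc m); k = suc (suc i); W = m + k in
    clusterCoeff l k * (k ! * k !) ≡ l * suc m * (m P′ i) * (W P′ i) * (suc W * l + k * suc i)
  clusterCoeff*k!² m i = begin
    ((l C k) * (suc W C k) + (m C i) * (W C k)) * K
      ≡⟨ *-distribʳ-+ K ((l C k) * (suc W C k)) ((m C i) * (W C k)) ⟩
    (l C k) * (suc W C k) * K + (m C i) * (W C k) * K
      ≡⟨ cong₂ _+_ leading trailing ⟩
    l * (suc m * x) * (suc W * (l * y)) + k * suc i * (x * (suc m * (l * y)))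
      ≡⟨ factor m i x y ⟩
    l * suc m * x * y * (suc W * l + k * suc i) ∎
    where
    open ≡-Reasoning
    l = suc (suc m)
    k = suc (suc i)
    K = k ! * k !
    W = m + k
    x = m P′ i
    y = W P′ i
    leading : (l C k) * (suc W C k) * K ≡ l * (suc m * x) * (suc W * (l * y))
    leading = trans (C*C*k!²≡P′*P′ l (suc W) k)
                    (cong₂ _*_ (P′-suc²-suc² m i)
                               (trans (P′-suc-suc W (suc i)) (cong (λ p → suc W * (p * y)) ([m+2+i]∸i≡2+m m i))))
    trailing : (m C i) * (W C k) * K ≡ k * suc i * (x * (suc m * (l * y)))
    trailing = trans (regroup (m C i) (W C k) (suc (suc i)) (suc i) (i !))
                     (cong (k * suc i *_) (cong₂ _*_ (C*k!≡P′ m i) (trans (C*k!≡P′ W k) ([m+2+i]P′[2+i] m i))))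
      where
      regroup : ∀ a b s t f → a * b * ((s * (t * f)) * (s * (t * f))) ≡ s * t * ((a * f) * (b * (s * (t * f))))
      regroup = solve-∀
    factor : ∀ m i x y → suc (suc m) * (suc m * x) * (suc (m + suc (suc i)) * (suc (suc m) * y))
                         + suc (suc i) * suc i * (x * (suc m * (suc (suc m) * y)))
                         ≡ suc (suc m) * suc m * x * y * (suc (m + suc (suc i)) * suc (suc m) + suc (suc i) * suc i)
    factor = solve-∀

  legendreCoeff-combination*k!² : ∀ m i → let l = suc (suc m); k = suc (suc i); W = m + k in
    ((4 + 3 * m) * legendreCoeff l k + l * legendreCoeff m k) * (k ! * k !)
      ≡ l * suc m * (m P′ i) * (W P′ i) * ((4 + 3 * m) * (suc (suc W) * suc W) + l * ((m ∸ suc i) * (m ∸ i)))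
  legendreCoeff-combination*k!² m i = begin
    ((4 + 3 * m) * legendreCoeff l k + l * legendreCoeff m k) * K
      ≡⟨ distrib (4 + 3 * m) (legendreCoeff l k) l (legendreCoeff m k) K ⟩
    (4 + 3 * m) * (legendreCoeff l k * K) + l * (legendreCoeff m k * K)
      ≡⟨ cong₂ (λ p q → (4 + 3 * m) * p + l * q)
               (trans (C*C*k!²≡P′*P′ l (l + k) k) (cong₂ _*_ (P′-suc²-suc² m i) (P′-suc²-suc² W i)))
               (trans (C*C*k!²≡P′*P′ m W k) (cong ((m P′ k) *_) ([m+2+i]P′[2+i] m i))) ⟩
    (4 + 3 * m) * (l * (suc m * x) * (suc (suc W) * (suc W * y)))
      + l * ((m ∸ suc i) * ((m ∸ i) * x) * (suc m * (l * y)))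
      ≡⟨ factor m i x y (m ∸ i) (m ∸ suc i) ⟩
    l * suc m * x * y * ((4 + 3 * m) * (suc (suc W) * suc W) + l * ((m ∸ suc i) * (m ∸ i))) ∎
    where
    open ≡-Reasoning
    l = suc (suc m)
    k = suc (suc i)
    K = k ! * k !
    W = m + k
    x = m P′ i
    y = W P′ i
    distrib : ∀ A α B β K → (A * α + B * β) * K ≡ A * (α * K) + B * (β * K)
    distrib = solve-∀
    factor : ∀ m i x y u v → (4 + 3 * m) * (suc (suc m) * (suc m * x) * (suc (suc (m + suc (suc i))) * (suc (m + suc (suc i)) * y)))
                             + suc (suc m) * (v * (u * x) * (suc m * (suc (suc m) * y)))
                             ≡ suc (suc m) * suc m * x * y * ((4 + 3 * m) * (suc (suc (m + suc (suc i))) * suc (m + suc (suc i)))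
                                                             + suc (suc m) * (v * u))
    factor = solve-∀

  clusterCoeff-legendre : ∀ m k → k ≤ suc (suc m) →
    2 * (3 + 2 * m) * clusterCoeff (suc (suc m)) k
      ≡ (4 + 3 * m) * legendreCoeff (suc (suc m)) k + suc (suc m) * legendreCoeff m k
  clusterCoeff-legendre m zero _ = at0 m
    where
    at0 : ∀ m → 2 * (3 + 2 * m) * (1 * 1 + 0) ≡ (4 + 3 * m) * (1 * 1) + suc (suc m) * (1 * 1)
    at0 = solve-∀
  clusterCoeff-legendre m (suc zero) _
    rewrite nC1≡n (suc (suc m)) | nC1≡n (suc (m + 1)) | nC1≡n (suc (suc m) + 1) | nC1≡n m | nC1≡n (m + 1)
    = at1 m
    where
    at1 : ∀ m → 2 * (3 + 2 * m) * (suc (suc m) * suc (m + 1) + 0)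
                ≡ (4 + 3 * m) * (suc (suc m) * (suc (suc m) + 1)) + suc (suc m) * (m * (m + 1))
    at1 = solve-∀
  clusterCoeff-legendre m (suc (suc i)) (s≤s (s≤s i≤m)) = *-cancelʳ-≡ _ _ K {{k !* k !≢0}} (begin
    N * clusterCoeff l k * K                    ≡⟨ *-assoc N (clusterCoeff l k) K ⟩
    N * (clusterCoeff l k * K)                  ≡⟨ cong (N *_) (clusterCoeff*k!² m i) ⟩
    N * (F * (suc W * l + k * suc i))           ≡⟨ x∙yz≈y∙xz N F _ ⟩
    F * (N * (suc W * l + k * suc i))           ≡⟨ cong (F *_) (clusterCoeff-legendre-reduced m i i≤m) ⟩
    F * ((4 + 3 * m) * (suc (suc W) * suc W) + l * ((m ∸ suc i) * (m ∸ i)))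
                                                ≡⟨ legendreCoeff-combination*k!² m i ⟨
    ((4 + 3 * m) * legendreCoeff l k + l * legendreCoeff m k) * K ∎)
    where
    open ≡-Reasoning
    N = 2 * (3 + 2 * m)
    l = suc (suc m)
    k = suc (suc i)
    K = k ! * k !
    W = m + k
    F = l * suc m * (m P′ i) * (W P′ i)

import Data.Nat as ℕ
open import Data.Nat.Properties using (m<n⇒m<1+n; ≤-refl; m≤n+m)
open import Data.Integer using (ℤ; +_; -_; _+_; _*_; _-_; _^_; 0ℤ; 1ℤ; -1ℤ)
open import Data.Integer.Properties using (pos-+; pos-*; *-zeroʳ; +-identityʳ; *-cancelˡ-≡)
open import Data.Integer.Tactic.RingSolver using (solve-∀)

sumTo-cong : ∀ n {f g : ℕ → ℤ} → (∀ k → k < n → f k ≡ g k) → sumTo n f ≡ sumTo n g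
sumTo-cong zero    f≗g = refl
sumTo-cong (suc n) f≗g = cong₂ _+_ (sumTo-cong n (λ k k<n → f≗g k (m<n⇒m<1+n k<n))) (f≗g n ≤-refl)

sumTo-+ : ∀ n (f g : ℕ → ℤ) → sumTo n (λ k → f k + g k) ≡ sumTo n f + sumTo n g
sumTo-+ zero    f g = refl
sumTo-+ (suc n) f g = trans (cong (_+ (f n + g n)) (sumTo-+ n f g)) (interchange (sumTo n f) (sumTo n g) (f n) (g n))
  where
  interchange : ∀ a b c d → a + b + (c + d) ≡ a + c + (b + d)
  interchange = solve-∀

sumTo-*ˡ : ∀ n a (f : ℕ → ℤ) → sumTo n (λ k → a * f k) ≡ a * sumTo n f
sumTo-*ˡ zero    a f = sym (*-zeroʳ a)
sumTo-*ˡ (suc n) a f = trans (cong (_+ a * f n) (sumTo-*ˡ n a f)) (distrib a (sumTo n f) (f n))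
  where
  distrib : ∀ a b c → a * b + a * c ≡ a * (b + c)
  distrib = solve-∀

sumTo-pad : ∀ n {f : ℕ → ℤ} → (∀ k → n ≤ k → f k ≡ 0ℤ) → ∀ d → sumTo (d ℕ.+ n) f ≡ sumTo n f
sumTo-pad n f-vanish zero    = refl
sumTo-pad n {f} f-vanish (suc d) = begin
  sumTo (d ℕ.+ n) f + f (d ℕ.+ n)    ≡⟨ cong (λ x → sumTo (d ℕ.+ n) f + x) (f-vanish (d ℕ.+ n) (m≤n+m n d)) ⟩
  sumTo (d ℕ.+ n) f + 0ℤ             ≡⟨ +-identityʳ _ ⟩
  sumTo (d ℕ.+ n) f                  ≡⟨ sumTo-pad n f-vanish d ⟩
  sumTo n f                          ∎
  where open ≡-Reasoning

eval : ℕ → (ℕ → ℕ) → ℤ → ℤ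
eval n c s = sumTo n (λ k → + c k * s ^ k)

eval-cong : ∀ n {c d : ℕ → ℕ} s → (∀ k → k < n → c k ≡ d k) → eval n c s ≡ eval n d s
eval-cong n s c≗d = sumTo-cong n (λ k k<n → cong (λ a → + a * s ^ k) (c≗d k k<n))

eval-+ : ∀ n (c d : ℕ → ℕ) s → eval n (λ k → c k ℕ.+ d k) s ≡ eval n c s + eval n d s
eval-+ n c d s = trans (sumTo-cong n (λ k _ → trans (cong (_* s ^ k) (pos-+ (c k) (d k))) (distrib (+ c k) (+ d k) (s ^ k))))
                       (sumTo-+ n _ _)
  where
  distrib : ∀ a b x → (a + b) * x ≡ a * x + b * x
  distrib = solve-∀

eval-* : ∀ n a (c : ℕ → ℕ) s → eval n (λ k → a ℕ.* c k) s ≡ + a * eval n c s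
eval-* n a c s = trans (sumTo-cong n (λ k _ → trans (cong (_* s ^ k) (pos-* a (c k))) (assoc (+ a) (+ c k) (s ^ k))))
                       (sumTo-*ˡ n (+ a) _)
  where
  assoc : ∀ a b x → a * b * x ≡ a * (b * x)
  assoc = solve-∀

eval-shift : ∀ n (c : ℕ → ℕ) s → eval (suc n) (shift c) s ≡ s * eval n c s
eval-shift zero    c s = zero-times s
  where
  zero-times : ∀ s → 0ℤ + 0ℤ * 1ℤ ≡ s * 0ℤ
  zero-times = solve-∀
eval-shift (suc n) c s = trans (cong (_+ + c n * (s * s ^ n)) (eval-shift n c s)) (distrib s (eval n c s) (+ c n) (s ^ n))
  where
  distrib : ∀ s e a x → s * e + a * (s * x) ≡ s * (e + a * x)
  distrib = solve-∀

eval-pad : ∀ n {c : ℕ → ℕ} s → (∀ k → n ≤ k → c k ≡ 0) → ∀ d → eval (d ℕ.+ n) c s ≡ eval n c s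
eval-pad n s c-vanish = sumTo-pad n (λ k n≤k → cong (λ a → + a * s ^ k) (c-vanish k n≤k))

-- legendre n s = P_n(1 + 2s) for the Legendre polynomial P_n.
legendre : ℕ → ℤ → ℤ
legendre n = eval (suc n) (legendreCoeff n)

legendre-pad : ∀ n d s → eval (d ℕ.+ suc n) (legendreCoeff n) s ≡ legendre n s
legendre-pad n d s = eval-pad (suc n) s (λ k n<k → legendreCoeff-vanish n<k) d

legendre-rec : ∀ m s →
  + suc (suc m) * legendre (suc (suc m)) s + + suc m * legendre m s
    ≡ + (3 ℕ.+ 2 ℕ.* m) * ((1ℤ + + 2 * s) * legendre (suc m) s)
legendre-rec m s = begin
  + suc (suc m) * legendre (suc (suc m)) s + + suc m * legendre m s
    ≡⟨ cong₂ _+_ (eval-* N (suc (suc m)) a₂ s) (trans (eval-* N (suc m) a₀ s) (cong (+ suc m *_) (legendre-pad m 2 s))) ⟨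
  eval N (λ k → suc (suc m) ℕ.* a₂ k) s + eval N (λ k → suc m ℕ.* a₀ k) s
    ≡⟨ eval-+ N (λ k → suc (suc m) ℕ.* a₂ k) (λ k → suc m ℕ.* a₀ k) s ⟨
  eval N (λ k → suc (suc m) ℕ.* a₂ k ℕ.+ suc m ℕ.* a₀ k) s
    ≡⟨ eval-cong N s (λ k k<N → legendreCoeff-rec m k (ℕ.≤-pred k<N)) ⟩
  eval N (λ k → (3 ℕ.+ 2 ℕ.* m) ℕ.* (a₁ k ℕ.+ 2 ℕ.* shift a₁ k)) s
    ≡⟨ eval-* N (3 ℕ.+ 2 ℕ.* m) (λ k → a₁ k ℕ.+ 2 ℕ.* shift a₁ k) s ⟩
  Z * eval N (λ k → a₁ k ℕ.+ 2 ℕ.* shift a₁ k) s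
    ≡⟨ cong (Z *_) (eval-+ N a₁ (λ k → 2 ℕ.* shift a₁ k) s) ⟩
  Z * (eval N a₁ s + eval N (λ k → 2 ℕ.* shift a₁ k) s)
    ≡⟨ cong (Z *_) (cong₂ _+_ (legendre-pad (suc m) 1 s)
                              (trans (eval-* N 2 (shift a₁) s) (cong (+ 2 *_) (eval-shift (suc (suc m)) a₁ s)))) ⟩
  Z * (legendre (suc m) s + + 2 * (s * legendre (suc m) s))
    ≡⟨ cong (Z *_) (factor s (legendre (suc m) s)) ⟩
  Z * ((1ℤ + + 2 * s) * legendre (suc m) s) ∎
  where
  open ≡-Reasoning
  N = 3 ℕ.+ m
  a₀ = legendreCoeff m
  a₁ = legendreCoeff (suc m)
  a₂ = legendreCoeff (suc (suc m))
  Z = + (3 ℕ.+ 2 ℕ.* m)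
  factor : ∀ s p → p + + 2 * (s * p) ≡ (1ℤ + + 2 * s) * p
  factor = solve-∀

legendre-reflect : ∀ n s → legendre n (-1ℤ - s) ≡ sign n * legendre n s
legendre-reflect n = proj₁ (reflect₂ n)
  where
  Reflects : ℕ → Set
  Reflects n = ∀ s → legendre n (-1ℤ - s) ≡ sign n * legendre n s
  reflect₁ : Reflects 1
  reflect₁ = linear
    where
    linear : ∀ s → 0ℤ + + 1 * 1ℤ + + 2 * ((-1ℤ - s) * 1ℤ) ≡ - 1ℤ * (0ℤ + + 1 * 1ℤ + + 2 * (s * 1ℤ))
    linear = solve-∀
  step : ∀ m → Reflects m → Reflects (suc m) → Reflects (suc (suc m))
  step m reflect₀ reflect₁ s = *-cancelˡ-≡ X _ _ (begin
    X * legendre (suc (suc m)) s′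
      ≡⟨ isolate X (legendre (suc (suc m)) s′) Y (legendre m s′) ⟩
    (X * legendre (suc (suc m)) s′ + Y * legendre m s′) - Y * legendre m s′
      ≡⟨ cong (_- Y * legendre m s′) (legendre-rec m s′) ⟩
    Z * ((1ℤ + + 2 * s′) * legendre (suc m) s′) - Y * legendre m s′
      ≡⟨ cong₂ (λ p q → Z * ((1ℤ + + 2 * s′) * p) - Y * q) (reflect₁ s) (reflect₀ s) ⟩
    Z * ((1ℤ + + 2 * s′) * (- sign m * legendre (suc m) s)) - Y * (sign m * legendre m s)
      ≡⟨ flip-sign (sign m) Z Y (legendre (suc m) s) (legendre m s) s ⟩
    sign (suc (suc m)) * (Z * ((1ℤ + + 2 * s) * legendre (suc m) s) - Y * legendre m s)
      ≡⟨ cong (λ p → sign (suc (suc m)) * (p - Y * legendre m s)) (legendre-rec m s) ⟨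
    sign (suc (suc m)) * ((X * legendre (suc (suc m)) s + Y * legendre m s) - Y * legendre m s)
      ≡⟨ cancel (sign (suc (suc m))) X (legendre (suc (suc m)) s) Y (legendre m s) ⟩
    X * (sign (suc (suc m)) * legendre (suc (suc m)) s) ∎)
    where
    open ≡-Reasoning
    s′ = -1ℤ - s
    X = + suc (suc m)
    Y = + suc m
    Z = + (3 ℕ.+ 2 ℕ.* m)
    isolate : ∀ x p y q → x * p ≡ (x * p + y * q) - y * q
    isolate = solve-∀
    flip-sign : ∀ σ z y p q s → z * ((1ℤ + + 2 * (-1ℤ - s)) * (- σ * p)) - y * (σ * q)
                              ≡ - - σ * (z * ((1ℤ + + 2 * s) * p) - y * q)
    flip-sign = solve-∀
    cancel : ∀ σ x p y q → σ * ((x * p + y * q) - y * q) ≡ x * (σ * p)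
    cancel = solve-∀
  reflect₂ : ∀ n → Reflects n × Reflects (suc n)
  reflect₂ zero    = (λ s → refl) , reflect₁
  reflect₂ (suc m) with reflect₂ m
  ... | reflect₀ , reflect₁ = reflect₁ , step m reflect₀ reflect₁

sign*^ : ∀ k t → sign k * t ^ k ≡ (- t) ^ k
sign*^ zero    t = refl
sign*^ (suc k) t = trans (regroup (sign k) t (t ^ k)) (cong (- t *_) (sign*^ k t))
  where
  regroup : ∀ σ t u → - σ * (t * u) ≡ - t * (σ * u)
  regroup = solve-∀

clusterPoly : ℕ → ℤ → ℤ
clusterPoly l = eval (suc l) (clusterCoeff l)

fD≡clusterPoly : ∀ l t → fD l t ≡ clusterPoly l (- t)
fD≡clusterPoly l t = sumTo-cong (suc l) (λ k _ →
  trans (regroup (sign k) (+ clusterCoeff l k) (t ^ k)) (cong (+ clusterCoeff l k *_) (sign*^ k t)))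
  where
  regroup : ∀ σ c u → σ * c * u ≡ c * (σ * u)
  regroup = solve-∀

clusterPoly-legendre : ∀ m s →
  + (2 ℕ.* (3 ℕ.+ 2 ℕ.* m)) * clusterPoly (suc (suc m)) s
    ≡ + (4 ℕ.+ 3 ℕ.* m) * legendre (suc (suc m)) s + + suc (suc m) * legendre m s
clusterPoly-legendre m s = begin
  + D * clusterPoly (suc (suc m)) s
    ≡⟨ eval-* N D (clusterCoeff (suc (suc m))) s ⟨
  eval N (λ k → D ℕ.* clusterCoeff (suc (suc m)) k) s
    ≡⟨ eval-cong N s (λ k k<N → clusterCoeff-legendre m k (ℕ.≤-pred k<N)) ⟩
  eval N (λ k → A ℕ.* legendreCoeff (suc (suc m)) k ℕ.+ B ℕ.* legendreCoeff m k) s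
    ≡⟨ eval-+ N (λ k → A ℕ.* legendreCoeff (suc (suc m)) k) (λ k → B ℕ.* legendreCoeff m k) s ⟩
  eval N (λ k → A ℕ.* legendreCoeff (suc (suc m)) k) s + eval N (λ k → B ℕ.* legendreCoeff m k) s
    ≡⟨ cong₂ _+_ (eval-* N A (legendreCoeff (suc (suc m))) s)
                 (trans (eval-* N B (legendreCoeff m) s) (cong (+ B *_) (legendre-pad m 2 s))) ⟩
  + A * legendre (suc (suc m)) s + + B * legendre m s ∎
  where
  open ≡-Reasoning
  N = 3 ℕ.+ m
  D = 2 ℕ.* (3 ℕ.+ 2 ℕ.* m)
  A = 4 ℕ.+ 3 ℕ.* m
  B = suc (suc m)

clusterPoly-reflect : ∀ m s →
  clusterPoly (suc (suc m)) (-1ℤ - s) ≡ sign (suc (suc m)) * clusterPoly (suc (suc m)) s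
clusterPoly-reflect m s = *-cancelˡ-≡ D _ _ (begin
  D * clusterPoly l (-1ℤ - s)
    ≡⟨ clusterPoly-legendre m (-1ℤ - s) ⟩
  A * legendre l (-1ℤ - s) + B * legendre m (-1ℤ - s)
    ≡⟨ cong₂ (λ p q → A * p + B * q) (legendre-reflect l s) (legendre-reflect m s) ⟩
  A * (sign l * legendre l s) + B * (sign m * legendre m s)
    ≡⟨ factor (sign m) A B (legendre l s) (legendre m s) ⟩
  sign l * (A * legendre l s + B * legendre m s)
    ≡⟨ cong (sign l *_) (clusterPoly-legendre m s) ⟨
  sign l * (D * clusterPoly l s)
    ≡⟨ swap (sign l) D (clusterPoly l s) ⟩
  D * (sign l * clusterPoly l s) ∎)
  where
  open ≡-Reasoning
  l = suc (suc m)
  D = + (2 ℕ.* (3 ℕ.+ 2 ℕ.* m))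
  A = + (4 ℕ.+ 3 ℕ.* m)
  B = + suc (suc m)
  factor : ∀ σ a b p q → a * (- - σ * p) + b * (σ * q) ≡ - - σ * (a * p + b * q)
  factor = solve-∀
  swap : ∀ σ x p → σ * (x * p) ≡ x * (σ * p)
  swap = solve-∀

lemma5p2 : (l : ℕ) → 4 ≤ l → (t : ℤ) → fD l t ≡ sign l * fD l (1ℤ - t)
lemma5p2 zero          ()        t
lemma5p2 (suc zero)    (s≤s ())  t
lemma5p2 (suc (suc m)) _         t = begin
  fD l t                                   ≡⟨ fD≡clusterPoly l t ⟩
  clusterPoly l (- t)                      ≡⟨ cong (clusterPoly l) (reparametrise t) ⟩
  clusterPoly l (-1ℤ - - (1ℤ - t))         ≡⟨ clusterPoly-reflect m (- (1ℤ - t)) ⟩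
  sign l * clusterPoly l (- (1ℤ - t))      ≡⟨ cong (sign l *_) (fD≡clusterPoly l (1ℤ - t)) ⟨
  sign l * fD l (1ℤ - t)                   ∎
  where
  open ≡-Reasoning
  l = suc (suc m)
  reparametrise : ∀ t → - t ≡ -1ℤ - - (1ℤ - t)
  reparametrise = solve-∀
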